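{- If the triple $(a,b,c)$ of positive integers is good and $n=a+b+c$, then $a\leq\lfloor n/2\rfloor$ and $c\leq\lfloor n/2\rfloor$.
   Context: For positive integers $a,b,c$ with $n=a+b+c$, the permutation of the triple $(a,b,c)$ is the permutation of $[n]$ with $p_i=n+1-i$ for $1\le i\le a$, $p_i=a+b+1-i$ for $a+1\le i\le a+b$, and $p_i=n+b+1-i$ for $a+b+1\le i\le n$ (one-line notation $n\cdots(n-a+1)\ b\cdots1\ (b+c)\cdots(b+1)$). The triple is good if this permutation, as a bijection $i\mapsto p_i$ of $[n]$, is a single $n$-cycle. -}

module Defs where

open import Data.Nat using (ℕ; zero; suc; _+_; _∸_; _≤_; _<_; _≤ᵇ_)
open import Data.Bool using (if_then_else_)
open import Data.Product using (∃-syntax; _×_)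
open import Relation.Binary.PropositionalEquality using (_≡_)

-- The permutation of the triple (a,b,c), as a function on positions i ∈ [n] (1-based),
-- n = a + b + c:
--   p i = n + 1 - i        for 1 ≤ i ≤ a
--   p i = a + b + 1 - i    for a+1 ≤ i ≤ a+b
--   p i = n + b + 1 - i    for a+b+1 ≤ i ≤ n
-- (values outside [n] are irrelevant.)
triplePerm : ℕ → ℕ → ℕ → ℕ → ℕ
triplePerm a b c i =
  if i ≤ᵇ a then (a + b + c + 1) ∸ i
  else if i ≤ᵇ a + b then (a + b + 1) ∸ i
  else (a + b + c + b + 1) ∸ i

iter : (ℕ → ℕ) → ℕ → ℕ → ℕ
iter f zero x = x
iter f (suc k) x = f (iter f k x)

-- A bijection p of [n] = {1,…,n} is a single n-cycle iff its cyclic group acts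
-- transitively: every j ∈ [n] lies in the orbit of every i ∈ [n].
IsSingleCycle : ℕ → (ℕ → ℕ) → Set
IsSingleCycle n p =
  ∀ i j → 1 ≤ i → i ≤ n → 1 ≤ j → j ≤ n → ∃[ k ] (iter p k i ≡ j)

Good : ℕ → ℕ → ℕ → Set
Good a b c = IsSingleCycle (a + b + c) (triplePerm a b c)

module Submission where

-- If a > b + c, the positions a and b + c + 1 both lie in the
-- first block, where p i = n + 1 - i, and their sum is n + 1; so p swaps them
-- and {a, b + c + 1} is a 2-cycle.  Likewise, if c > a + b, the positions
-- c + b and a + b + 1 lie in the third block, where p i = n + b + 1 - i, and
-- add up to n + b + 1, so p swaps them.  In both cases neither position is 1,
-- whereas an n-cycle cannot contain a 2-cycle avoiding a point of [n]: the
-- orbit of a swapped point stays inside the swapped pair.  Hence a ≤ b + c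
-- and c ≤ a + b, i.e. 2a ≤ n and 2c ≤ n, which gives a, c ≤ ⌊n/2⌋.

open import Defs
open import Data.Nat using (ℕ; zero; suc; _+_; _*_; _∸_; _≤_; _<_; _/_; _≤ᵇ_; _≤?_)
open import Data.Nat.Properties
open import Data.Nat.DivMod using (m*n/n≡m; /-monoˡ-≤)
open import Data.Nat.Tactic.RingSolver using (solve-∀)
open import Data.Bool using (true; false; T)
open import Data.Sum using (_⊎_; inj₁; inj₂)
open import Data.Product using (_×_; _,_)
open import Data.Empty using (⊥; ⊥-elim)
open import Relation.Nullary using (yes; no)
open import Relation.Binary.PropositionalEquality

swap-orbit : ∀ (f : ℕ → ℕ) {x y} → f x ≡ y → f y ≡ x →
             ∀ k → iter f k x ≡ x ⊎ iter f k x ≡ y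
swap-orbit f fx≡y fy≡x zero = inj₁ refl
swap-orbit f fx≡y fy≡x (suc k) with swap-orbit f fx≡y fy≡x k
... | inj₁ e = inj₂ (trans (cong f e) fx≡y)
... | inj₂ e = inj₁ (trans (cong f e) fy≡x)

-- A single n-cycle that swaps two points x, y must hit 1, since the point 1 of
-- [n] lies in the orbit of x; so the swapped pair cannot avoid 1.
cycle-swap-avoiding-one : ∀ {n p x y} → IsSingleCycle n p → p x ≡ y → p y ≡ x →
                          1 < x → x ≤ n → 1 < y → ⊥
cycle-swap-avoiding-one {p = p} cycle px≡y py≡x 1<x x≤n 1<y
  with cycle _ 1 (<⇒≤ 1<x) x≤n ≤-refl (≤-trans (<⇒≤ 1<x) x≤n)
... | k , reaches-1 with swap-orbit p px≡y py≡x k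
...   | inj₁ e = <⇒≢ 1<x (trans (sym reaches-1) e)
...   | inj₂ e = <⇒≢ 1<y (trans (sym reaches-1) e)

∸-of-sum : ∀ {m x y} → x + y ≡ m → m ∸ x ≡ y
∸-of-sum {x = x} {y} refl = m+n∸m≡n x y

perm-first-block : ∀ a b c {x y} → x ≤ a → x + y ≡ a + b + c + 1 →
                   triplePerm a b c x ≡ y
perm-first-block a b c {x} x≤a sum with x ≤ᵇ a in test
... | true  = ∸-of-sum sum
... | false = ⊥-elim (subst T test (≤⇒≤ᵇ x≤a))

perm-third-block : ∀ a b c {x y} → a + b < x → x + y ≡ a + b + c + b + 1 →
                   triplePerm a b c x ≡ y
perm-third-block a b c {x} a+b<x sum with x ≤ᵇ a in test₁ | x ≤ᵇ a + b in test₂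
... | true  | _     = ⊥-elim (<⇒≱ (≤-<-trans (m≤m+n a b) a+b<x)
                                       (≤ᵇ⇒≤ x a (subst T (sym test₁) _)))
... | false | true  = ⊥-elim (<⇒≱ a+b<x (≤ᵇ⇒≤ x (a + b) (subst T (sym test₂) _)))
... | false | false = ∸-of-sum sum

-- In a good triple the first block is at most as long as the other two:
-- otherwise a and b + c + 1 form a 2-cycle avoiding 1.
good⇒a≤b+c : ∀ a b c → 1 ≤ b → Good a b c → a ≤ b + c
good⇒a≤b+c a b c 1≤b good with a ≤? b + c
... | yes a≤b+c = a≤b+c
... | no a≰b+c = ⊥-elim
  (cycle-swap-avoiding-one good pa≡y py≡a (<-≤-trans 1<y y≤a) a≤n 1<y)
  where
  y : ℕ
  y = b + c + 1
  y≤a : y ≤ a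
  y≤a = subst (_≤ a) (+-comm 1 (b + c)) (≰⇒> a≰b+c)
  1<y : 1 < y
  1<y = +-monoˡ-≤ 1 (≤-trans 1≤b (m≤m+n b c))
  a≤n : a ≤ a + b + c
  a≤n = ≤-trans (m≤m+n a b) (m≤m+n (a + b) c)
  pair-sum : ∀ a b c → a + (b + c + 1) ≡ a + b + c + 1
  pair-sum = solve-∀
  pa≡y : triplePerm a b c a ≡ y
  pa≡y = perm-first-block a b c ≤-refl (pair-sum a b c)
  py≡a : triplePerm a b c y ≡ a
  py≡a = perm-first-block a b c y≤a (trans (+-comm y a) (pair-sum a b c))

-- In a good triple the third block is at most as long as the other two:
-- otherwise c + b and a + b + 1 form a 2-cycle avoiding 1.
good⇒c≤a+b : ∀ a b c → 1 ≤ b → Good a b c → c ≤ a + b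
good⇒c≤a+b a b c 1≤b good with c ≤? a + b
... | yes c≤a+b = c≤a+b
... | no c≰a+b = ⊥-elim
  (cycle-swap-avoiding-one good px≡y py≡x (≤-<-trans (≤-trans 1≤b (m≤n+m b a)) a+b<x) x≤n 1<y)
  where
  x y : ℕ
  x = c + b
  y = a + b + 1
  a+b<c : a + b < c
  a+b<c = ≰⇒> c≰a+b
  a+b<x : a + b < x
  a+b<x = +-monoˡ-< b (≤-<-trans (m≤m+n a b) a+b<c)
  a+b<y : a + b < y
  a+b<y = subst (a + b <_) (+-comm 1 (a + b)) ≤-refl
  1<y : 1 < y
  1<y = +-monoˡ-≤ 1 (≤-trans 1≤b (m≤n+m b a))
  x≤n : x ≤ a + b + c
  x≤n = subst (x ≤_) (regroup a b c) (m≤n+m x a)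
    where
    regroup : ∀ a b c → a + (c + b) ≡ a + b + c
    regroup = solve-∀
  pair-sum : ∀ a b c → c + b + (a + b + 1) ≡ a + b + c + b + 1
  pair-sum = solve-∀
  px≡y : triplePerm a b c x ≡ y
  px≡y = perm-third-block a b c a+b<x (pair-sum a b c)
  py≡x : triplePerm a b c y ≡ x
  py≡x = perm-third-block a b c a+b<y (trans (+-comm y x) (pair-sum a b c))

double≤⇒≤half : ∀ m n → m + m ≤ n → m ≤ n / 2
double≤⇒≤half m n m+m≤n = subst (_≤ n / 2) (m*n/n≡m m 2)
  (/-monoˡ-≤ 2 (subst (_≤ n) (double-as-product m) m+m≤n))
  where
  double-as-product : ∀ m → m + m ≡ m * 2
  double-as-product = solve-∀

proposition3 : (a b c : ℕ) → 1 ≤ a → 1 ≤ b → 1 ≤ c → Good a b c →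
    (a ≤ (a + b + c) / 2) × (c ≤ (a + b + c) / 2)
proposition3 a b c _ 1≤b _ good =
  double≤⇒≤half a (a + b + c) 2a≤n , double≤⇒≤half c (a + b + c) 2c≤n
  where
  2a≤n : a + a ≤ a + b + c
  2a≤n = subst (a + a ≤_) (sym (+-assoc a b c)) (+-monoʳ-≤ a (good⇒a≤b+c a b c 1≤b good))
  2c≤n : c + c ≤ a + b + c
  2c≤n = +-monoˡ-≤ c (good⇒c≤a+b a b c 1≤b good)
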